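{- There exist a function $\epsilon\colon\mathbb N\to(0,1)$, a family of monotone Boolean functions $\{f_n\colon\{0,1\}^n\to\{0,1\}\}_{n\in\mathbb N}$ and a family of distributions $\{\mu_n\}_{n\in\mathbb N}$ with $\mu_n$ supported on $f_n^{ -1}(1)$ such that: (1) there are CNF formulas $\phi_n$ of size at most $n^{O(1)}$ with $\phi_n^{ -1}(1)\subseteq f_n^{ -1}(1)$ and $\Pr_{x\sim\mu_n}[\phi_n(x)=1]\ge\epsilon(n)$; whereas (2) any monotone CNF formulas $\phi_n^+$ with $(\phi_n^+)^{ -1}(1)\subseteq f_n^{ -1}(1)$ and $\Pr_{x\sim\mu_n}[\phi_n^+(x)=1]\ge\epsilon(n)$ must have size $2^{n^{\Omega(1)}}$.
   Context: A CNF formula is an AND of clauses (ORs of literals); it is monotone if no literal is negated; its size is its number of clauses. A Boolean function is monotone if $x\le y$ coordinatewise implies $f(x)\le f(y)$. -}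

module Defs where

open import Data.Bool as B using (Bool; true; false; if_then_else_; _∧_; _∨_; not)
open import Data.Nat as N using (ℕ; zero; suc)
open import Data.Fin using (Fin)
open import Data.Vec using (Vec; []; _∷_; lookup)
open import Data.List using (List; []; _∷_; map; _++_; foldr; length)
open import Data.Bool.ListAction using (all; any)
open import Data.List.Relation.Unary.All using (All)
open import Data.Rational as Q using (ℚ; 0ℚ; 1ℚ; _+_)
open import Data.Vec.Relation.Binary.Pointwise.Inductive using (Pointwise)
open import Relation.Binary.PropositionalEquality using (_≡_; _≢_)

Cube : ℕ → Set
Cube n = Vec Bool n

BoolFun : ℕ → Set
BoolFun n = Cube n → Bool

_≤ᶜ_ : ∀ {n} → Cube n → Cube n → Set
x ≤ᶜ y = Pointwise B._≤_ x y

IsMonotone : ∀ {n} → BoolFun n → Set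
IsMonotone {n} f = ∀ (x y : Cube n) → x ≤ᶜ y → f x B.≤ f y

data Literal (n : ℕ) : Set where
  pos : Fin n → Literal n
  neg : Fin n → Literal n

Clause : ℕ → Set
Clause n = List (Literal n)

CNF : ℕ → Set
CNF n = List (Clause n)

evalLit : ∀ {n} → Literal n → Cube n → Bool
evalLit (pos i) x = lookup x i
evalLit (neg i) x = not (lookup x i)

evalClause : ∀ {n} → Clause n → Cube n → Bool
evalClause c x = any (λ l → evalLit l x) c

evalCNF : ∀ {n} → CNF n → Cube n → Bool
evalCNF φ x = all (λ c → evalClause c x) φ

size : ∀ {n} → CNF n → ℕ
size φ = length φ

IsPositive : ∀ {n} → Literal n → Set
IsPositive (pos _) = Data.Unit.⊤ where import Data.Unit
IsPositive (neg _) = Data.Empty.⊥ where import Data.Empty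

IsMonotoneCNF : ∀ {n} → CNF n → Set
IsMonotoneCNF φ = All (All IsPositive) φ

_⊆₁_ : ∀ {n} → BoolFun n → BoolFun n → Set
_⊆₁_ {n} g f = ∀ (x : Cube n) → g x ≡ true → f x ≡ true

allCube : (n : ℕ) → List (Cube n)
allCube zero = [] ∷ []
allCube (suc n) = map (false ∷_) (allCube n) ++ map (true ∷_) (allCube n)

sumWhere : ∀ {n} → (Cube n → ℚ) → (Cube n → Bool) → ℚ
sumWhere {n} w P = foldr (λ x acc → (if P x then w x else 0ℚ) + acc) 0ℚ (allCube n)

record Distribution (n : ℕ) : Set where
  field
    mass     : Cube n → ℚ
    nonneg   : ∀ x → 0ℚ Q.≤ mass x
    total    : sumWhere mass (λ _ → true) ≡ 1ℚ
open Distribution public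

Pr : ∀ {n} → Distribution n → BoolFun n → ℚ
Pr μ g = sumWhere (mass μ) g

SupportedOn : ∀ {n} → Distribution n → BoolFun n → Set
SupportedOn {n} μ f = ∀ (x : Cube n) → mass μ x ≢ 0ℚ → f x ≡ true

module Submission where

-- For n = 2m (+1) the variables come in m pairs, and f_n = ⋁ᵢ (x_{2i} ∧ x_{2i+1})
-- ("some pair is switched on").  The distribution μ_n puts its mass on the points eᵢ
-- in which exactly pair i is on: mass ½, ¼, … on the first pairs and the remaining
-- mass on the last one.  The threshold ε(n) is chosen so that 1 < ε(n) + δ(n), where
-- δ(n) is the smallest mass of a support point; hence an event of probability ≥ ε(n)
-- must contain every eᵢ (lemma 'forced').
--
-- (1) The CNF  (x₀ ∨ x₂ ∨ …) ∧ ⋀ᵢ (¬x_{2i} ∨ x_{2i+1})  has ⌊n/2⌋+1 clauses, only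
--     accepts points of f⁻¹(1), and accepts every eᵢ, so it has probability 1.
-- (2) A monotone CNF ψ that accepts every eᵢ and only points of f⁻¹(1) has at least
--     2^⌊n/2⌋ clauses: every clause contains x₀ or x₁ (it is satisfied by e₀), so
--     restricting the first pair to (1,0), resp. (0,1), kills disjoint sets of clauses
--     and leaves two CNFs of the same kind on the remaining pairs.

open import Defs
open import Data.Nat using (ℕ; _≤_; _^_)
open import Data.Rational using (ℚ; 0ℚ; 1ℚ) renaming (_<_ to _<ℚ_; _≤_ to _≤ℚ_)
open import Data.Product using (Σ; _×_; ∃-syntax)

open import Algebra.Bundles using (CommutativeMonoid)
import Algebra.Properties.CommutativeSemigroup as CommSemigroupProperties
open import Data.Bool as B using (Bool; true; false; _∧_; _∨_; not; if_then_else_; f≤t; b≤b)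
import Data.Bool.Properties as BP
open import Data.Bool.ListAction using (any)
open import Data.Empty using (⊥-elim)
open import Data.Fin using (splitAt) renaming (zero to fzero; suc to fsuc)
open import Data.List as List using (List; []; _∷_; map; foldr; length)
open import Data.List.Membership.Propositional using (_∈_)
open import Data.List.Membership.Propositional.Properties using (∈-map⁺; ∈-++⁺ˡ; ∈-++⁺ʳ)
open import Data.List.Properties using (length-map)
open import Data.List.Relation.Unary.All using (All; []; _∷_)
open import Data.List.Relation.Unary.Any using (here; there)
open import Data.Nat as N using (zero; suc; z≤n; s≤s; _+_; ⌊_/2⌋)
import Data.Nat.Properties as NP
open import Data.Product using (_,_; proj₂)
open import Data.Rational using (½) renaming (_+_ to _+ℚ_; _*_ to _*ℚ_)
import Data.Rational.Properties as QP
open import Data.Sum using (_⊎_; inj₁; inj₂; [_,_]′)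
open import Data.Unit using (tt)
open import Data.Vec using (Vec; []; _∷_; _++_; lookup; replicate; zipWith)
open import Data.Vec.Properties using (lookup-splitAt; lookup-zipWith; lookup-replicate)
import Data.Vec.Relation.Binary.Pointwise.Inductive as Pointwise
open Pointwise using (_∷_)
open import Relation.Binary.PropositionalEquality
open import Relation.Nullary using (yes; no)
open import Relation.Nullary.Decidable using (toWitness)

private
  module ∨ = CommSemigroupProperties (CommutativeMonoid.commutativeSemigroup BP.∨-commutativeMonoid)

sumOver : {A : Set} → List A → (A → ℚ) → ℚ
sumOver xs h = foldr (λ x acc → h x +ℚ acc) 0ℚ xs

sumOver-++ : {A : Set} (xs ys : List A) (h : A → ℚ) →
             sumOver (xs List.++ ys) h ≡ sumOver xs h +ℚ sumOver ys h
sumOver-++ []       ys h = sym (QP.+-identityˡ _)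
sumOver-++ (x ∷ xs) ys h =
  trans (cong (h x +ℚ_) (sumOver-++ xs ys h)) (sym (QP.+-assoc (h x) _ _))

sumOver-map : {A B : Set} (g : A → B) (xs : List A) (h : B → ℚ) →
              sumOver (map g xs) h ≡ sumOver xs (λ x → h (g x))
sumOver-map g []       h = refl
sumOver-map g (x ∷ xs) h = cong (h (g x) +ℚ_) (sumOver-map g xs h)

sumOver-cong : {A : Set} (xs : List A) {h h′ : A → ℚ} →
               (∀ x → h x ≡ h′ x) → sumOver xs h ≡ sumOver xs h′
sumOver-cong []       eq = refl
sumOver-cong (x ∷ xs) eq = cong₂ _+ℚ_ (eq x) (sumOver-cong xs eq)

sumOver-mono : {A : Set} (xs : List A) {h h′ : A → ℚ} →
               (∀ x → h x ≤ℚ h′ x) → sumOver xs h ≤ℚ sumOver xs h′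
sumOver-mono []       le = QP.≤-refl
sumOver-mono (x ∷ xs) le = QP.+-mono-≤ (le x) (sumOver-mono xs le)

sumOver-zero : {A : Set} (xs : List A) → sumOver xs (λ _ → 0ℚ) ≡ 0ℚ
sumOver-zero []       = refl
sumOver-zero (x ∷ xs) = cong (0ℚ +ℚ_) (sumOver-zero xs)

sumOver-scale : {A : Set} (xs : List A) (q : ℚ) (h : A → ℚ) →
                sumOver xs (λ x → q *ℚ h x) ≡ q *ℚ sumOver xs h
sumOver-scale []       q h = sym (QP.*-zeroʳ q)
sumOver-scale (x ∷ xs) q h =
  trans (cong (q *ℚ h x +ℚ_) (sumOver-scale xs q h)) (sym (QP.*-distribˡ-+ q (h x) _))

sumOver-drop : {A : Set} {h w : A → ℚ} {x : A} (xs : List A) →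
               (∀ y → h y ≤ℚ w y) → h x ≡ 0ℚ → x ∈ xs →
               sumOver xs h +ℚ w x ≤ℚ sumOver xs w
sumOver-drop {h = h} {w} {x} (x ∷ xs) h≤w hx≡0 (here refl) = begin
  (h x +ℚ sumOver xs h) +ℚ w x  ≡⟨ cong (λ t → (t +ℚ sumOver xs h) +ℚ w x) hx≡0 ⟩
  (0ℚ +ℚ sumOver xs h) +ℚ w x   ≡⟨ cong (_+ℚ w x) (QP.+-identityˡ (sumOver xs h)) ⟩
  sumOver xs h +ℚ w x           ≤⟨ QP.+-monoˡ-≤ (w x) (sumOver-mono xs h≤w) ⟩
  sumOver xs w +ℚ w x           ≡⟨ QP.+-comm (sumOver xs w) (w x) ⟩
  w x +ℚ sumOver xs w           ∎
  where open QP.≤-Reasoning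
sumOver-drop {h = h} {w} {x} (y ∷ xs) h≤w hx≡0 (there x∈xs) = begin
  (h y +ℚ sumOver xs h) +ℚ w x  ≡⟨ QP.+-assoc (h y) _ _ ⟩
  h y +ℚ (sumOver xs h +ℚ w x)  ≤⟨ QP.+-mono-≤ (h≤w y) (sumOver-drop xs h≤w hx≡0 x∈xs) ⟩
  w y +ℚ sumOver xs w           ∎
  where open QP.≤-Reasoning

allCube-complete : ∀ {n} (x : Cube n) → x ∈ allCube n
allCube-complete []          = here refl
allCube-complete (false ∷ x) = ∈-++⁺ˡ (∈-map⁺ (false ∷_) (allCube-complete x))
allCube-complete {suc n} (true ∷ x) =
  ∈-++⁺ʳ (map (false ∷_) (allCube n)) (∈-map⁺ (true ∷_) (allCube-complete x))

sumCube-suc : ∀ n (h : Cube (suc n) → ℚ) →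
              sumOver (allCube (suc n)) h
              ≡ sumOver (allCube n) (λ x → h (false ∷ x)) +ℚ sumOver (allCube n) (λ x → h (true ∷ x))
sumCube-suc n h = trans (sumOver-++ (map (false ∷_) (allCube n)) _ h)
                        (cong₂ _+ℚ_ (sumOver-map _ (allCube n) h) (sumOver-map _ (allCube n) h))

isZero : ∀ {n} → Cube n → Bool
isZero []      = true
isZero (b ∷ x) = not b ∧ isZero x

isZero-replicate : ∀ n → isZero (replicate n false) ≡ true
isZero-replicate zero    = refl
isZero-replicate (suc n) = isZero-replicate n

isZero⇒replicate : ∀ {n} (x : Cube n) → isZero x ≡ true → x ≡ replicate n false
isZero⇒replicate []          _  = refl
isZero⇒replicate (false ∷ x) eq = cong (false ∷_) (isZero⇒replicate x eq)

sumCube-atZero : ∀ n (c : ℚ) → sumOver (allCube n) (λ x → if isZero x then c else 0ℚ) ≡ c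
sumCube-atZero zero    c = QP.+-identityʳ c
sumCube-atZero (suc n) c = begin
  sumOver (allCube (suc n)) (λ x → if isZero x then c else 0ℚ)
    ≡⟨ sumCube-suc n (λ x → if isZero x then c else 0ℚ) ⟩
  sumOver (allCube n) (λ x → if isZero x then c else 0ℚ) +ℚ sumOver (allCube n) (λ _ → 0ℚ)
    ≡⟨ cong₂ _+ℚ_ (sumCube-atZero n c) (sumOver-zero (allCube n)) ⟩
  c +ℚ 0ℚ
    ≡⟨ QP.+-identityʳ c ⟩
  c ∎
  where open ≡-Reasoning

Pr-certain : ∀ {n} (μ : Distribution n) (P : BoolFun n) → SupportedOn μ P → Pr μ P ≡ 1ℚ
Pr-certain {n} μ P supp = trans (sumOver-cong (allCube n) onSupport) (total μ)
  where
  onSupport : ∀ x → (if P x then mass μ x else 0ℚ) ≡ mass μ x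
  onSupport x with P x in Px | mass μ x QP.≟ 0ℚ
  ... | true  | _       = refl
  ... | false | yes m≡0 = sym m≡0
  ... | false | no  m≢0 with () ← trans (sym (supp x m≢0)) Px

Pr-miss : ∀ {n} (μ : Distribution n) (P : BoolFun n) (x : Cube n) →
          P x ≡ false → Pr μ P +ℚ mass μ x ≤ℚ 1ℚ
Pr-miss {n} μ P x Px = QP.≤-trans
  (sumOver-drop (allCube n) restricted≤mass (cong (λ b → if b then mass μ x else 0ℚ) Px)
                (allCube-complete x))
  (QP.≤-reflexive (total μ))
  where
  restricted≤mass : ∀ y → (if P y then mass μ y else 0ℚ) ≤ℚ mass μ y
  restricted≤mass y with P y
  ... | true  = QP.≤-refl
  ... | false = nonneg μ y

forced : ∀ {n} (μ : Distribution n) (P : BoolFun n) {ε δ : ℚ} → 1ℚ <ℚ ε +ℚ δ →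
         ε ≤ℚ Pr μ P → (x : Cube n) → δ ≤ℚ mass μ x → P x ≡ true
forced μ P 1<ε+δ ε≤Pr x δ≤mass with P x in Px
... | true  = refl
... | false = ⊥-elim (QP.<-irrefl refl
                (QP.<-≤-trans 1<ε+δ (QP.≤-trans (QP.+-mono-≤ ε≤Pr δ≤mass) (Pr-miss μ P x Px))))

liftLit : ∀ {n} → Literal n → Literal (suc n)
liftLit (pos i) = pos (fsuc i)
liftLit (neg i) = neg (fsuc i)

liftClause : ∀ {n} → Clause n → Clause (suc n)
liftClause = map liftLit

liftCNF : ∀ {n} → CNF n → CNF (suc n)
liftCNF = map liftClause

liftClause-eval : ∀ {n} (c : Clause n) (b : Bool) (x : Cube n) →
                  evalClause (liftClause c) (b ∷ x) ≡ evalClause c x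
liftClause-eval []          b x = refl
liftClause-eval (pos i ∷ c) b x = cong (lookup x i ∨_) (liftClause-eval c b x)
liftClause-eval (neg i ∷ c) b x = cong (not (lookup x i) ∨_) (liftClause-eval c b x)

liftCNF-eval : ∀ {n} (ψ : CNF n) (b : Bool) (x : Cube n) →
               evalCNF (liftCNF ψ) (b ∷ x) ≡ evalCNF ψ x
liftCNF-eval []      b x = refl
liftCNF-eval (c ∷ ψ) b x = cong₂ _∧_ (liftClause-eval c b x) (liftCNF-eval ψ b x)

restrictLit : ∀ {k n} → Vec Bool k → Literal (k + n) → Bool ⊎ Literal n
restrictLit {k} a (pos i) = [ (λ j → inj₁ (lookup a j)) , (λ j → inj₂ (pos j)) ]′ (splitAt k i)
restrictLit {k} a (neg i) = [ (λ j → inj₁ (not (lookup a j))) , (λ j → inj₂ (neg j)) ]′ (splitAt k i)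

evalRestricted : ∀ {n} → Bool ⊎ Literal n → Cube n → Bool
evalRestricted (inj₁ b) x = b
evalRestricted (inj₂ l) x = evalLit l x

fixedTrue : ∀ {n} → Bool ⊎ Literal n → Bool
fixedTrue (inj₁ b) = b
fixedTrue (inj₂ _) = false

keepFree : ∀ {n} → Bool ⊎ Literal n → Clause n → Clause n
keepFree (inj₁ _) c = c
keepFree (inj₂ l) c = l ∷ c

satisfiedBy : ∀ {k n} → Vec Bool k → Clause (k + n) → Bool
satisfiedBy a c = any (λ l → fixedTrue (restrictLit a l)) c

residual : ∀ {k n} → Vec Bool k → Clause (k + n) → Clause n
residual a []      = []
residual a (l ∷ c) = keepFree (restrictLit a l) (residual a c)

restrict : ∀ {k n} → Vec Bool k → CNF (k + n) → CNF n
restrict a []      = []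
restrict a (c ∷ ψ) = if satisfiedBy a c then restrict a ψ else residual a c ∷ restrict a ψ

restrictLit-eval : ∀ {k n} (a : Vec Bool k) (x : Cube n) (l : Literal (k + n)) →
                   evalLit l (a ++ x) ≡ evalRestricted (restrictLit a l) x
restrictLit-eval {k} a x (pos i) with splitAt k i | lookup-splitAt k a x i
... | inj₁ _ | eq = eq
... | inj₂ _ | eq = eq
restrictLit-eval {k} a x (neg i) with splitAt k i | lookup-splitAt k a x i
... | inj₁ _ | eq = cong not eq
... | inj₂ _ | eq = cong not eq

keepFree-eval : ∀ {n} (r : Bool ⊎ Literal n) (s : Bool) (c : Clause n) (x : Cube n) →
                evalRestricted r x ∨ (s ∨ evalClause c x)
                ≡ (fixedTrue r ∨ s) ∨ evalClause (keepFree r c) x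
keepFree-eval (inj₁ b) s c x = sym (BP.∨-assoc b s _)
keepFree-eval (inj₂ l) s c x = ∨.x∙yz≈y∙xz (evalLit l x) s _

restrictClause-eval : ∀ {k n} (a : Vec Bool k) (x : Cube n) (c : Clause (k + n)) →
                      evalClause c (a ++ x) ≡ satisfiedBy a c ∨ evalClause (residual a c) x
restrictClause-eval a x []      = refl
restrictClause-eval a x (l ∷ c) =
  trans (cong₂ _∨_ (restrictLit-eval a x l) (restrictClause-eval a x c))
        (keepFree-eval (restrictLit a l) (satisfiedBy a c) (residual a c) x)

restrict-eval : ∀ {k n} (a : Vec Bool k) (x : Cube n) (ψ : CNF (k + n)) →
                evalCNF ψ (a ++ x) ≡ evalCNF (restrict a ψ) x
restrict-eval a x []      = refl
restrict-eval a x (c ∷ ψ) rewrite restrictClause-eval a x c with satisfiedBy a c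
... | true  = restrict-eval a x ψ
... | false = cong (evalClause (residual a c) x ∧_) (restrict-eval a x ψ)

restrict-size : ∀ {k n} (a b : Vec Bool k) (ψ : CNF (k + n)) →
                All (λ c → satisfiedBy a c ∨ satisfiedBy b c ≡ true) ψ →
                size (restrict a ψ) + size (restrict b ψ) ≤ size ψ
restrict-size a b [] [] = z≤n
restrict-size a b (c ∷ ψ) (covered ∷ rest) with satisfiedBy a c | satisfiedBy b c
... | true  | true  = NP.m≤n⇒m≤1+n (restrict-size a b ψ rest)
... | true  | false = NP.≤-trans (NP.≤-reflexive (NP.+-suc _ _)) (s≤s (restrict-size a b ψ rest))
... | false | true  = s≤s (restrict-size a b ψ rest)
restrict-size a b (c ∷ ψ) (() ∷ rest) | false | false

∨-mono-≤ : ∀ {a a′ b b′} → a B.≤ a′ → b B.≤ b′ → (a ∨ b) B.≤ (a′ ∨ b′)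
∨-mono-≤ {b = b} f≤t _ = BP.≤-maximum b
∨-mono-≤ {true}  b≤b _ = b≤b
∨-mono-≤ {false} b≤b q = q

∧-mono-≤ : ∀ {a a′ b b′} → a B.≤ a′ → b B.≤ b′ → (a ∧ b) B.≤ (a′ ∧ b′)
∧-mono-≤ {b′ = b′} f≤t _ = BP.≤-minimum b′
∧-mono-≤ {true}  b≤b q = q
∧-mono-≤ {false} b≤b _ = b≤b

≤-true : ∀ {a b} → a B.≤ b → a ≡ true → b ≡ true
≤-true b≤b eq = eq
≤-true f≤t _  = refl

∧-trueˡ : ∀ {a b} → a ∧ b ≡ true → a ≡ true
∧-trueˡ {true} _ = refl

∧-trueʳ : ∀ a {b} → a ∧ b ≡ true → b ≡ true
∧-trueʳ true eq = eq

evalCNF-monotone : ∀ {n} (ψ : CNF n) → IsMonotoneCNF ψ → IsMonotone (evalCNF ψ)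
evalCNF-monotone []      _           x y x≤y = b≤b
evalCNF-monotone (c ∷ ψ) (pc ∷ pψ) x y x≤y =
  ∧-mono-≤ (clause c pc) (evalCNF-monotone ψ pψ x y x≤y)
  where
  clause : (c : Clause _) → All IsPositive c → evalClause c x B.≤ evalClause c y
  clause []          []       = b≤b
  clause (pos i ∷ c) (_ ∷ pc) = ∨-mono-≤ (Pointwise.lookup x≤y i) (clause c pc)

positive-zeros : ∀ {n} (c : Clause n) → All IsPositive c → evalClause c (replicate n false) ≡ false
positive-zeros []          []       = refl
positive-zeros (pos i ∷ c) (_ ∷ pc) = cong₂ _∨_ (lookup-replicate i false) (positive-zeros c pc)

rejecting-nonempty : ∀ {n} (ψ : CNF n) {g : BoolFun n} (x : Cube n) →
                     evalCNF ψ ⊆₁ g → g x ≡ false → 1 ≤ size ψ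
rejecting-nonempty []      x sound gx with () ← trans (sym (sound x refl)) gx
rejecting-nonempty (_ ∷ _) x sound gx = s≤s z≤n

residual-positive : ∀ {k n} (a : Vec Bool k) (c : Clause (k + n)) →
                    All IsPositive c → All IsPositive (residual a c)
residual-positive a []          []       = []
residual-positive {k} a (pos i ∷ c) (_ ∷ pc) with splitAt k i
... | inj₁ _ = residual-positive a c pc
... | inj₂ _ = tt ∷ residual-positive a c pc

restrict-positive : ∀ {k n} (a : Vec Bool k) (ψ : CNF (k + n)) →
                    IsMonotoneCNF ψ → IsMonotoneCNF (restrict a ψ)
restrict-positive a []      []        = []
restrict-positive a (c ∷ ψ) (pc ∷ pψ) with satisfiedBy a c
... | true  = restrict-positive a ψ pψ
... | false = residual-positive a c pc ∷ restrict-positive a ψ pψ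

satisfiedBy-∨ : ∀ {k n} (a b : Vec Bool k) (c : Clause (k + n)) → All IsPositive c →
                satisfiedBy (zipWith _∨_ a b) c ≡ satisfiedBy a c ∨ satisfiedBy b c
satisfiedBy-∨ a b []          []       = refl
satisfiedBy-∨ {k} a b (pos i ∷ c) (_ ∷ pc) =
  trans (cong₂ _∨_ literal (satisfiedBy-∨ a b c pc))
        (∨.interchange (fixedTrue (restrictLit a (pos i))) (fixedTrue (restrictLit b (pos i))) _ _)
  where
  literal : fixedTrue (restrictLit (zipWith _∨_ a b) (pos i))
            ≡ fixedTrue (restrictLit a (pos i)) ∨ fixedTrue (restrictLit b (pos i))
  literal with splitAt k i
  ... | inj₁ j = lookup-zipWith _∨_ j a b
  ... | inj₂ _ = refl

-- Covering: if a monotone CNF accepts (a ∨ b) followed by zeros, every clause is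
-- satisfied by a or by b (the zeros cannot satisfy a positive residual).
covered : ∀ {k n} (a b : Vec Bool k) (ψ : CNF (k + n)) → IsMonotoneCNF ψ →
          evalCNF ψ (zipWith _∨_ a b ++ replicate n false) ≡ true →
          All (λ c → satisfiedBy a c ∨ satisfiedBy b c ≡ true) ψ
covered a b []      []        _  = []
covered {n = n} a b (c ∷ ψ) (pc ∷ pψ) accepts =
  clause ∷ covered a b ψ pψ (∧-trueʳ (evalClause c _) accepts)
  where
  ab = zipWith _∨_ a b
  clause : satisfiedBy a c ∨ satisfiedBy b c ≡ true
  clause = begin
    satisfiedBy a c ∨ satisfiedBy b c
      ≡⟨ sym (satisfiedBy-∨ a b c pc) ⟩
    satisfiedBy ab c
      ≡⟨ sym (BP.∨-identityʳ _) ⟩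
    satisfiedBy ab c ∨ false
      ≡⟨ cong (satisfiedBy ab c ∨_) (sym (positive-zeros (residual ab c) (residual-positive ab c pc))) ⟩
    satisfiedBy ab c ∨ evalClause (residual ab c) (replicate n false)
      ≡⟨ sym (restrictClause-eval ab (replicate n false) c) ⟩
    evalClause c (ab ++ replicate n false)
      ≡⟨ ∧-trueˡ accepts ⟩
    true ∎
    where open ≡-Reasoning

anyPair : (n : ℕ) → BoolFun n
anyPair zero                _           = false
anyPair (suc zero)          _           = false
anyPair (suc (suc n))       (a ∷ b ∷ x) = (a ∧ b) ∨ anyPair n x

anyPair-monotone : ∀ n → IsMonotone (anyPair n)
anyPair-monotone zero          x           y           _                 = b≤b
anyPair-monotone (suc zero)    x           y           _                 = b≤b
anyPair-monotone (suc (suc n)) (a ∷ b ∷ x) (c ∷ d ∷ y) (a≤c ∷ b≤d ∷ x≤y) =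
  ∨-mono-≤ (∧-mono-≤ a≤c b≤d) (anyPair-monotone n x y x≤y)

data InSupport : (n : ℕ) → Cube n → Set where
  firstPair : ∀ {m} → InSupport (suc (suc m)) (true ∷ true ∷ replicate m false)
  laterPair : ∀ {m x} → InSupport m x → InSupport (suc (suc m)) (false ∷ false ∷ x)

anyPair-support : ∀ {n x} → InSupport n x → anyPair n x ≡ true
anyPair-support firstPair     = refl
anyPair-support (laterPair p) = anyPair-support p

0<½ : 0ℚ <ℚ ½
0<½ = toWitness {a? = 0ℚ QP.<? ½} tt

½<1 : ½ <ℚ 1ℚ
½<1 = toWitness {a? = ½ QP.<? 1ℚ} tt

0≤1 : 0ℚ ≤ℚ 1ℚ
0≤1 = QP.<⇒≤ (QP.<-trans 0<½ ½<1)

-- the mass of the first pair: ½, or everything if it is the last pair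
firstWeight : ℕ → ℚ
firstWeight zero          = 1ℚ
firstWeight (suc zero)    = 1ℚ
firstWeight (suc (suc _)) = ½

firstWeight-nonneg : ∀ m → 0ℚ ≤ℚ firstWeight m
firstWeight-nonneg zero          = 0≤1
firstWeight-nonneg (suc zero)    = 0≤1
firstWeight-nonneg (suc (suc _)) = QP.<⇒≤ 0<½

-- the (sub-)probability mass function; it is 0 in dimensions 0 and 1
pairMass : (n : ℕ) → Cube n → ℚ
pairMass zero          _                   = 0ℚ
pairMass (suc zero)    _                   = 0ℚ
pairMass (suc (suc m)) (true  ∷ true  ∷ x) = if isZero x then firstWeight m else 0ℚ
pairMass (suc (suc m)) (false ∷ false ∷ x) = ½ *ℚ pairMass m x
pairMass (suc (suc m)) (true  ∷ false ∷ _) = 0ℚ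
pairMass (suc (suc m)) (false ∷ true  ∷ _) = 0ℚ

pairMass-nonneg : ∀ n (x : Cube n) → 0ℚ ≤ℚ pairMass n x
pairMass-nonneg zero          _                   = QP.≤-refl
pairMass-nonneg (suc zero)    _                   = QP.≤-refl
pairMass-nonneg (suc (suc m)) (true  ∷ true  ∷ x) with isZero x
... | true  = firstWeight-nonneg m
... | false = QP.≤-refl
pairMass-nonneg (suc (suc m)) (false ∷ false ∷ x) = QP.*-monoˡ-≤-nonNeg ½ (pairMass-nonneg m x)
pairMass-nonneg (suc (suc m)) (true  ∷ false ∷ _) = QP.≤-refl
pairMass-nonneg (suc (suc m)) (false ∷ true  ∷ _) = QP.≤-refl

pairMass-sum : ∀ m → sumOver (allCube (suc (suc m))) (pairMass (suc (suc m)))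
                     ≡ ½ *ℚ sumOver (allCube m) (pairMass m) +ℚ firstWeight m
pairMass-sum m = begin
  sumOver (allCube (suc (suc m))) M
    ≡⟨ sumCube-suc (suc m) M ⟩
  sumOver (allCube (suc m)) (λ x → M (false ∷ x)) +ℚ sumOver (allCube (suc m)) (λ x → M (true ∷ x))
    ≡⟨ cong₂ _+ℚ_ (sumCube-suc m (λ x → M (false ∷ x))) (sumCube-suc m (λ x → M (true ∷ x))) ⟩
  (S (λ x → ½ *ℚ pairMass m x) +ℚ S (λ _ → 0ℚ)) +ℚ (S (λ _ → 0ℚ) +ℚ S (λ x → if isZero x then firstWeight m else 0ℚ))
    ≡⟨ cong₂ _+ℚ_ (cong₂ _+ℚ_ (sumOver-scale (allCube m) ½ (pairMass m)) (sumOver-zero (allCube m)))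
                  (cong₂ _+ℚ_ (sumOver-zero (allCube m)) (sumCube-atZero m (firstWeight m))) ⟩
  (½ *ℚ S (pairMass m) +ℚ 0ℚ) +ℚ (0ℚ +ℚ firstWeight m)
    ≡⟨ cong₂ _+ℚ_ (QP.+-identityʳ (½ *ℚ S (pairMass m))) (QP.+-identityˡ (firstWeight m)) ⟩
  ½ *ℚ S (pairMass m) +ℚ firstWeight m ∎
  where
  open ≡-Reasoning
  M = pairMass (suc (suc m))
  S : (Cube m → ℚ) → ℚ
  S = sumOver (allCube m)

pairMass-total : ∀ m → sumOver (allCube (suc (suc m))) (pairMass (suc (suc m))) ≡ 1ℚ
pairMass-total zero          =
  trans (pairMass-sum zero) (cong (λ s → ½ *ℚ s +ℚ 1ℚ) (sumOver-zero (allCube zero)))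
pairMass-total (suc zero)    =
  trans (pairMass-sum (suc zero)) (cong (λ s → ½ *ℚ s +ℚ 1ℚ) (sumOver-zero (allCube (suc zero))))
pairMass-total (suc (suc m)) =
  trans (pairMass-sum (suc (suc m))) (cong (λ s → ½ *ℚ s +ℚ ½) (pairMass-total m))

pairMass-support : ∀ n (x : Cube n) → pairMass n x ≢ 0ℚ → InSupport n x
pairMass-support zero          _                   m≢0 = ⊥-elim (m≢0 refl)
pairMass-support (suc zero)    _                   m≢0 = ⊥-elim (m≢0 refl)
pairMass-support (suc (suc m)) (true  ∷ true  ∷ x) m≢0 with isZero x in x≡0
... | true  rewrite isZero⇒replicate x x≡0 = firstPair
... | false = ⊥-elim (m≢0 refl)
pairMass-support (suc (suc m)) (false ∷ false ∷ x) m≢0 =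
  laterPair (pairMass-support m x (λ m≡0 → m≢0 (trans (cong (½ *ℚ_) m≡0) (QP.*-zeroʳ ½))))
pairMass-support (suc (suc m)) (true  ∷ false ∷ _) m≢0 = ⊥-elim (m≢0 refl)
pairMass-support (suc (suc m)) (false ∷ true  ∷ _) m≢0 = ⊥-elim (m≢0 refl)

-- δ(n) = 2^{1-⌊n/2⌋} (and 1 for n < 2): every eᵢ has mass at least δ(n)
minMass : ℕ → ℚ
minMass zero                      = 1ℚ
minMass (suc zero)                = 1ℚ
minMass (suc (suc zero))          = 1ℚ
minMass (suc (suc (suc zero)))    = 1ℚ
minMass (suc (suc (suc (suc m)))) = ½ *ℚ minMass (suc (suc m))

-- ε(n) = 1 - 2^{-⌊n/2⌋} (and ½ for n < 2)
threshold : ℕ → ℚ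
threshold zero                      = ½
threshold (suc zero)                = ½
threshold (suc (suc zero))          = ½
threshold (suc (suc (suc zero)))    = ½
threshold (suc (suc (suc (suc m)))) = ½ +ℚ ½ *ℚ threshold (suc (suc m))

-- needed to compare δ with the weight ½ of the first pair
minMass≤1 : ∀ n → minMass n ≤ℚ 1ℚ
minMass≤1 zero                      = QP.≤-refl
minMass≤1 (suc zero)                = QP.≤-refl
minMass≤1 (suc (suc zero))          = QP.≤-refl
minMass≤1 (suc (suc (suc zero)))    = QP.≤-refl
minMass≤1 (suc (suc (suc (suc m)))) = QP.≤-trans (QP.*-monoˡ-≤-nonNeg ½ (minMass≤1 (suc (suc m))))
                                                 (QP.<⇒≤ ½<1)

minMass-support : ∀ {n x} → InSupport n x → minMass n ≤ℚ pairMass n x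
minMass-support (firstPair {m}) rewrite isZero-replicate m = first m
  where
  first : ∀ m → minMass (suc (suc m)) ≤ℚ firstWeight m
  first zero          = QP.≤-refl
  first (suc zero)    = QP.≤-refl
  first (suc (suc m)) = QP.*-monoˡ-≤-nonNeg ½ (minMass≤1 (suc (suc m)))
minMass-support (laterPair {zero} ())
minMass-support (laterPair {suc zero} ())
minMass-support (laterPair {suc (suc m)} p) = QP.*-monoˡ-≤-nonNeg ½ (minMass-support p)

threshold-bounds : ∀ n → (0ℚ <ℚ threshold n) × (threshold n <ℚ 1ℚ)
threshold-bounds zero                      = 0<½ , ½<1
threshold-bounds (suc zero)                = threshold-bounds zero
threshold-bounds (suc (suc zero))          = threshold-bounds zero
threshold-bounds (suc (suc (suc zero)))    = threshold-bounds zero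
threshold-bounds (suc (suc (suc (suc m)))) with threshold-bounds (suc (suc m))
... | 0<ε , ε<1 = QP.+-mono-<-≤ 0<½ (QP.*-monoˡ-≤-nonNeg ½ (QP.<⇒≤ 0<ε))
                , QP.+-monoʳ-< ½ (QP.*-monoʳ-<-pos ½ ε<1)

-- the hypothesis of 'forced': induction using ε' + δ' = ½ + ½(ε + δ)
threshold+minMass : ∀ n → 1ℚ <ℚ threshold n +ℚ minMass n
threshold+minMass zero                      = toWitness {a? = 1ℚ QP.<? ½ +ℚ 1ℚ} tt
threshold+minMass (suc zero)                = threshold+minMass zero
threshold+minMass (suc (suc zero))          = threshold+minMass zero
threshold+minMass (suc (suc (suc zero)))    = threshold+minMass zero
threshold+minMass (suc (suc (suc (suc m)))) = begin-strict
  1ℚ                              ≡⟨⟩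
  ½ +ℚ ½ *ℚ 1ℚ                    <⟨ QP.+-monoʳ-< ½ (QP.*-monoʳ-<-pos ½ (threshold+minMass (suc (suc m)))) ⟩
  ½ +ℚ ½ *ℚ (ε +ℚ δ)              ≡⟨ cong (½ +ℚ_) (QP.*-distribˡ-+ ½ ε δ) ⟩
  ½ +ℚ (½ *ℚ ε +ℚ ½ *ℚ δ)         ≡⟨ QP.+-assoc ½ (½ *ℚ ε) (½ *ℚ δ) ⟨
  (½ +ℚ ½ *ℚ ε) +ℚ ½ *ℚ δ         ∎
  where
  open QP.≤-Reasoning
  ε = threshold (suc (suc m))
  δ = minMass (suc (suc m))

someFirst : (n : ℕ) → Clause n
someFirst zero          = []
someFirst (suc zero)    = []
someFirst (suc (suc m)) = pos fzero ∷ liftClause (liftClause (someFirst m))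

pairImplications : (n : ℕ) → CNF n
pairImplications zero          = []
pairImplications (suc zero)    = []
pairImplications (suc (suc m)) =
  (neg fzero ∷ pos (fsuc fzero) ∷ []) ∷ liftCNF (liftCNF (pairImplications m))

smallCNF : (n : ℕ) → CNF n
smallCNF zero          = []
smallCNF (suc zero)    = []
smallCNF (suc (suc m)) = someFirst (suc (suc m)) ∷ pairImplications (suc (suc m))

lift²Clause-eval : ∀ {n} (c : Clause n) (a b : Bool) (x : Cube n) →
                   evalClause (liftClause (liftClause c)) (a ∷ b ∷ x) ≡ evalClause c x
lift²Clause-eval c a b x = trans (liftClause-eval (liftClause c) a (b ∷ x)) (liftClause-eval c b x)

lift²CNF-eval : ∀ {n} (ψ : CNF n) (a b : Bool) (x : Cube n) →
                evalCNF (liftCNF (liftCNF ψ)) (a ∷ b ∷ x) ≡ evalCNF ψ x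
lift²CNF-eval ψ a b x = trans (liftCNF-eval (liftCNF ψ) a (b ∷ x)) (liftCNF-eval ψ b x)

-- Soundness: the first pair with its first variable on has its second variable on too.
smallCNF-pairs : ∀ n (x : Cube n) → evalClause (someFirst n) x ≡ true →
                 evalCNF (pairImplications n) x ≡ true → anyPair n x ≡ true
smallCNF-pairs zero          _                   () _
smallCNF-pairs (suc zero)    _                   () _
smallCNF-pairs (suc (suc m)) (true  ∷ true  ∷ x) _  _  = refl
smallCNF-pairs (suc (suc m)) (true  ∷ false ∷ x) _  ()
smallCNF-pairs (suc (suc m)) (false ∷ b     ∷ x) some implications =
  smallCNF-pairs m x (trans (sym (lift²Clause-eval (someFirst m) false b x)) some)
                     (trans (sym (lift²CNF-eval (pairImplications m) false b x)) implications)

implications-zeros : ∀ n → evalCNF (pairImplications n) (replicate n false) ≡ true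
implications-zeros zero          = refl
implications-zeros (suc zero)    = refl
implications-zeros (suc (suc m)) =
  trans (lift²CNF-eval (pairImplications m) false false _) (implications-zeros m)

smallCNF-support : ∀ {n x} → InSupport n x → evalCNF (smallCNF n) x ≡ true
smallCNF-support (firstPair {m}) =
  trans (lift²CNF-eval (pairImplications m) true true _) (implications-zeros m)
smallCNF-support (laterPair {zero} ())
smallCNF-support (laterPair {suc zero} ())
smallCNF-support (laterPair {suc (suc m)} {x} p) =
  trans (cong₂ _∧_ (lift²Clause-eval (someFirst (suc (suc m))) false false x)
                   (lift²CNF-eval (pairImplications (suc (suc m))) false false x))
        (smallCNF-support p)

pairImplications-size : ∀ n → size (pairImplications n) ≡ ⌊ n /2⌋
pairImplications-size zero          = refl
pairImplications-size (suc zero)    = refl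
pairImplications-size (suc (suc m)) = cong suc (begin
  length (liftCNF (liftCNF (pairImplications m)))  ≡⟨ length-map liftClause (liftCNF (pairImplications m)) ⟩
  length (liftCNF (pairImplications m))            ≡⟨ length-map liftClause (pairImplications m) ⟩
  length (pairImplications m)                      ≡⟨ pairImplications-size m ⟩
  ⌊ m /2⌋                                          ∎)
  where open ≡-Reasoning

smallCNF-size : ∀ n → 2 ≤ n → size (smallCNF n) ≤ n ^ 1
smallCNF-size (suc zero)    (s≤s ())
smallCNF-size (suc (suc m)) _ = begin
  suc (size (pairImplications (suc (suc m))))  ≡⟨ cong suc (pairImplications-size (suc (suc m))) ⟩
  suc (suc ⌊ m /2⌋)                            ≤⟨ s≤s (s≤s (NP.⌊n/2⌋≤n m)) ⟩
  suc (suc m)                                  ≡⟨ NP.^-identityʳ (suc (suc m)) ⟨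
  suc (suc m) ^ 1                              ∎
  where open NP.≤-Reasoning

-- By induction on the pairs: fixing the first pair to 10, resp. 01, yields two CNFs of
-- the same kind on the remaining pairs, and each clause survives in at most one of them.
monotone-lowerBound : ∀ n (ψ : CNF n) → IsMonotoneCNF ψ → evalCNF ψ ⊆₁ anyPair n →
                      (∀ x → InSupport n x → evalCNF ψ x ≡ true) → 2 ^ ⌊ n /2⌋ ≤ size ψ
monotone-lowerBound zero       ψ _ sound _ = rejecting-nonempty ψ [] sound refl
monotone-lowerBound (suc zero) ψ _ sound _ = rejecting-nonempty ψ (false ∷ []) sound refl
monotone-lowerBound (suc (suc m)) ψ mono sound accepts = begin
  2 ^ ⌊ m /2⌋ + (2 ^ ⌊ m /2⌋ + 0)                ≡⟨ cong (2 ^ ⌊ m /2⌋ +_) (NP.+-identityʳ _) ⟩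
  2 ^ ⌊ m /2⌋ + 2 ^ ⌊ m /2⌋                      ≤⟨ NP.+-mono-≤ bound₁₀ bound₀₁ ⟩
  size (restrict a₁₀ ψ) + size (restrict a₀₁ ψ)  ≤⟨ restrict-size a₁₀ a₀₁ ψ everyClauseCovered ⟩
  size ψ                                         ∎
  where
  open NP.≤-Reasoning
  a₁₀ a₀₁ : Vec Bool 2
  a₁₀ = true ∷ false ∷ []
  a₀₁ = false ∷ true ∷ []
  equal : ∀ {k} (x : Cube k) → x ≤ᶜ x
  equal _ = Pointwise.refl BP.≤-refl
  -- e₀ = 11 0…0 is accepted, so every clause contains x₀ or x₁
  everyClauseCovered : All (λ c → satisfiedBy a₁₀ c ∨ satisfiedBy a₀₁ c ≡ true) ψ
  everyClauseCovered = covered a₁₀ a₀₁ ψ mono (accepts _ firstPair)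
  restricted : (a : Vec Bool 2) → (∀ x → anyPair (suc (suc m)) (a ++ x) ≡ anyPair m x) →
               (∀ x → (false ∷ false ∷ x) ≤ᶜ (a ++ x)) → 2 ^ ⌊ m /2⌋ ≤ size (restrict a ψ)
  restricted a pairOff above = monotone-lowerBound m (restrict a ψ) (restrict-positive a ψ mono)
    (λ x accepted → trans (sym (pairOff x)) (sound (a ++ x) (trans (restrict-eval a x ψ) accepted)))
    (λ x p → trans (sym (restrict-eval a x ψ))
                   (≤-true (evalCNF-monotone ψ mono _ _ (above x)) (accepts _ (laterPair p))))
  bound₁₀ : 2 ^ ⌊ m /2⌋ ≤ size (restrict a₁₀ ψ)
  bound₁₀ = restricted a₁₀ (λ _ → refl) (λ x → f≤t ∷ b≤b ∷ equal x)
  bound₀₁ : 2 ^ ⌊ m /2⌋ ≤ size (restrict a₀₁ ψ)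
  bound₀₁ = restricted a₀₁ (λ _ → refl) (λ x → b≤b ∷ f≤t ∷ equal x)

-- k² ≤ n gives k ≤ ⌊n/2⌋ (for n ≥ 2), so 2^⌊n/2⌋ is of the form 2^{n^{Ω(1)}}.
square≤⇒≤half : ∀ k n → 2 ≤ n → k ^ 2 ≤ n → k ≤ ⌊ n /2⌋
square≤⇒≤half zero          n _   _    = z≤n
square≤⇒≤half (suc zero)    n 2≤n _    = NP.⌊n/2⌋-mono 2≤n
square≤⇒≤half (suc (suc j)) n _   k²≤n = begin
  k                 ≡⟨ NP.n≡⌊n+n/2⌋ k ⟩
  ⌊ k + k /2⌋       ≤⟨ NP.⌊n/2⌋-mono k+k≤n ⟩
  ⌊ n /2⌋           ∎
  where
  open NP.≤-Reasoning
  k = suc (suc j)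
  k+k≤n : k + k ≤ n
  k+k≤n = begin
    k + k           ≡⟨ cong (k +_) (NP.+-identityʳ k) ⟨
    2 N.* k         ≤⟨ NP.*-monoˡ-≤ k {2} {k} (s≤s (s≤s z≤n)) ⟩
    k N.* k         ≡⟨ cong (k N.*_) (NP.^-identityʳ k) ⟨
    k ^ 2           ≤⟨ k²≤n ⟩
    n               ∎

f : (n : ℕ) → BoolFun n
f zero          _ = true
f (suc zero)    _ = true
f (suc (suc m))   = anyPair (suc (suc m))

pointAtZero : ∀ n → Distribution n
pointAtZero n = record
  { mass   = λ x → if isZero x then 1ℚ else 0ℚ
  ; nonneg = nonneg′
  ; total  = sumCube-atZero n 1ℚ
  }
  where
  nonneg′ : ∀ x → 0ℚ ≤ℚ (if isZero x then 1ℚ else 0ℚ)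
  nonneg′ x with isZero x
  ... | true  = 0≤1
  ... | false = QP.≤-refl

-- μ_n: the pair distribution for n ≥ 2 (for n < 2 any distribution would do)
μ : (n : ℕ) → Distribution n
μ zero          = pointAtZero zero
μ (suc zero)    = pointAtZero (suc zero)
μ (suc (suc m)) = record
  { mass   = pairMass (suc (suc m))
  ; nonneg = pairMass-nonneg (suc (suc m))
  ; total  = pairMass-total m
  }

supported : ∀ m (P : BoolFun (suc (suc m))) →
            (∀ {x} → InSupport (suc (suc m)) x → P x ≡ true) → SupportedOn (μ (suc (suc m))) P
supported m P onSupport x m≢0 = onSupport (pairMass-support (suc (suc m)) x m≢0)

f-monotone : ∀ n → IsMonotone (f n)
f-monotone zero          _ _ _ = b≤b
f-monotone (suc zero)    _ _ _ = b≤b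
f-monotone (suc (suc m))       = anyPair-monotone (suc (suc m))

μ-supported : ∀ n → SupportedOn (μ n) (f n)
μ-supported zero          _ _ = refl
μ-supported (suc zero)    _ _ = refl
μ-supported (suc (suc m))     = supported m (f (suc (suc m))) anyPair-support

smallCNF-sound : ∀ n → evalCNF (smallCNF n) ⊆₁ f n
smallCNF-sound zero          _ _        = refl
smallCNF-sound (suc zero)    _ _        = refl
smallCNF-sound (suc (suc m)) x accepted =
  smallCNF-pairs (suc (suc m)) x (∧-trueˡ accepted)
                 (∧-trueʳ (evalClause (someFirst (suc (suc m))) x) accepted)

smallCNF-likely : ∀ n → threshold n ≤ℚ Pr (μ n) (evalCNF (smallCNF n))
smallCNF-likely n = QP.≤-trans (QP.<⇒≤ (proj₂ (threshold-bounds n)))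
                               (QP.≤-reflexive (sym (Pr-certain (μ n) _ (certain n))))
  where
  certain : ∀ n → SupportedOn (μ n) (evalCNF (smallCNF n))
  certain zero          _ _ = refl
  certain (suc zero)    _ _ = refl
  certain (suc (suc m))     = supported m _ smallCNF-support

-- a monotone CNF of probability ≥ ε(n) accepts every eᵢ, hence is large
monotone-large : ∀ n → 2 ≤ n → (ψ : CNF n) → IsMonotoneCNF ψ → evalCNF ψ ⊆₁ f n →
                 threshold n ≤ℚ Pr (μ n) (evalCNF ψ) → (k : ℕ) → k ^ 2 ≤ n → 2 ^ k ≤ size ψ
monotone-large (suc zero)    (s≤s ())
monotone-large (suc (suc m)) 2≤n ψ mono sound likely k k²≤n =
  NP.≤-trans (NP.^-monoʳ-≤ 2 (square≤⇒≤half k (suc (suc m)) 2≤n k²≤n))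
             (monotone-lowerBound (suc (suc m)) ψ mono sound acceptsAll)
  where
  acceptsAll : ∀ x → InSupport (suc (suc m)) x → evalCNF ψ x ≡ true
  acceptsAll x p = forced (μ (suc (suc m))) (evalCNF ψ) (threshold+minMass (suc (suc m)))
                          likely x (minMass-support p)

theorem4p1 :
    Σ (ℕ → ℚ) λ ε →
    Σ ((n : ℕ) → BoolFun n) λ f →
    Σ ((n : ℕ) → Distribution n) λ μ →
      ((n : ℕ) → (0ℚ <ℚ ε n) × (ε n <ℚ 1ℚ))
      × ((n : ℕ) → IsMonotone (f n))
      × ((n : ℕ) → SupportedOn (μ n) (f n))
      × (Σ ((n : ℕ) → CNF n) λ φ →
           ((n : ℕ) → (evalCNF (φ n) ⊆₁ f n) × (ε n ≤ℚ Pr (μ n) (evalCNF (φ n))))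
           × (∃[ c ] ∃[ n₀ ] ((n : ℕ) → n₀ ≤ n → size (φ n) ≤ n ^ c)))
      × (∃[ a ] ∃[ n₀ ] ((n : ℕ) → n₀ ≤ n → (ψ : CNF n) → IsMonotoneCNF ψ
           → evalCNF ψ ⊆₁ f n → ε n ≤ℚ Pr (μ n) (evalCNF ψ)
           → (k : ℕ) → k ^ a ≤ n → 2 ^ k ≤ size ψ))
theorem4p1 =
  threshold , f , μ ,
  threshold-bounds , f-monotone , μ-supported ,
  (smallCNF , (λ n → smallCNF-sound n , smallCNF-likely n) , 1 , 2 , smallCNF-size) ,
  (2 , 2 , monotone-large)
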